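{- Let ${\rm D}$ be an atomic integral domain that contains $\mathbb{N}$. Let ${\rm U}$ denote the set of units of ${\rm D}$. Assume there exists an integer $n\ge 2$ such that the equation $$u_xX^n+u_yY^n=u_zZ^n$$ has no solution with $u_x,u_y,u_z\in {\rm U}$ and $X,Y,Z\in {\rm D}-\{0\}$. Then ${\rm D}$ has an infinite number of irreducibles (up to units).
   Context: $\mathbb{N}=\{0,1,2,\ldots\}$. A unit of an integral domain ${\rm D}$ is $u\in{\rm D}$ such that $uv=1$ for some $v\in{\rm D}$. An irreducible is a non-unit $p$ such that whenever $p=ab$, $a$ or $b$ is a unit. Two irreducibles $p,q$ are equivalent if $p=uq$ for some unit $u$; "${\rm D}$ has an infinite number of irreducibles (up to units)" means there are infinitely many equivalence classes. ${\rm D}$ is atomic if every nonzero non-unit element can be written (not necessarily uniquely) as a product $p_1^{x_1}\cdots p_m^{x_m}$ of irreducibles. -}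

module Defs where

open import Level using (Level; _⊔_)
open import Data.Nat using (ℕ; zero; suc)
open import Data.Product using (Σ; ∃; _×_; _,_)
open import Data.Sum using (_⊎_)
open import Data.List using (List; foldr)
open import Data.List.Relation.Unary.All using (All)
open import Data.List.Relation.Unary.Any using (Any)
open import Relation.Nullary using (¬_)
open import Relation.Binary.PropositionalEquality using (_≡_)
open import Algebra.Bundles using (CommutativeRing)

module _ {c ℓ : Level} (R : CommutativeRing c ℓ) where
  open CommutativeRing R

  IsIntegralDomain : Set (c ⊔ ℓ)
  IsIntegralDomain =
    ¬ (1# ≈ 0#) × (∀ x y → x * y ≈ 0# → (x ≈ 0#) ⊎ (y ≈ 0#))

  ι : ℕ → Carrier
  ι zero = 0#
  ι (suc n) = 1# + ι n

  Containsℕ : Set ℓ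
  Containsℕ = ∀ m n → ι m ≈ ι n → m ≡ n

  pow : Carrier → ℕ → Carrier
  pow x zero = 1#
  pow x (suc n) = x * pow x n

  IsUnit : Carrier → Set (c ⊔ ℓ)
  IsUnit u = ∃ λ v → u * v ≈ 1#

  IsIrreducible : Carrier → Set (c ⊔ ℓ)
  IsIrreducible p = ¬ IsUnit p × (∀ a b → p ≈ a * b → IsUnit a ⊎ IsUnit b)

  Associated : Carrier → Carrier → Set (c ⊔ ℓ)
  Associated p q = ∃ λ u → IsUnit u × p ≈ u * q

  product : List Carrier → Carrier
  product = foldr _*_ 1#

  IsAtomic : Set (c ⊔ ℓ)
  IsAtomic = ∀ x → ¬ (x ≈ 0#) → ¬ IsUnit x →
    Σ (List Carrier) λ ps → All IsIrreducible ps × product ps ≈ x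

  FinitelyManyIrreducibles : Set (c ⊔ ℓ)
  FinitelyManyIrreducibles =
    Σ (List Carrier) λ ps → ∀ p → IsIrreducible p → Any (Associated p) ps

  HasUnitFermatSolution : ℕ → Set (c ⊔ ℓ)
  HasUnitFermatSolution n =
    Σ Carrier λ ux → Σ Carrier λ uy → Σ Carrier λ uz →
    Σ Carrier λ X → Σ Carrier λ Y → Σ Carrier λ Z →
      IsUnit ux × IsUnit uy × IsUnit uz ×
      ¬ (X ≈ 0#) × ¬ (Y ≈ 0#) × ¬ (Z ≈ 0#) ×
      (ux * pow X n + uy * pow Y n ≈ uz * pow Z n)

-- Euclid's argument.  If p₁, …, pₖ were all the irreducibles up to units, let P be the
-- product of the nonzero ones; every irreducible divides P.  For n ≥ 1 the element
-- Pⁿ + 1 is not a unit, for otherwise 1·Pⁿ + 1·1ⁿ = (Pⁿ + 1)·1ⁿ would be a solution; if it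
-- is nonzero, atomicity gives it an irreducible factor q, and q divides both Pⁿ and Pⁿ + 1,
-- hence 1.  If Pⁿ + 1 = 0 then P is a unit, so there are no irreducibles at all, and the
-- same argument with P replaced by 1 applies to 1ⁿ + 1 = 2, which is nonzero as D ⊇ ℕ.
module Submission where

open import Defs
open import Level using (Level)
open import Data.Nat using (ℕ; _≥_; zero; suc)
open import Data.Product using (Σ; ∃; _×_; _,_; proj₁; proj₂)
open import Data.Sum using (inj₁; inj₂)
open import Data.List using (List; []; _∷_)
open import Data.List.Relation.Unary.All using (All; []; _∷_)
open import Data.List.Relation.Unary.Any using (Any; here; there)
open import Data.List.Membership.Propositional using (_∈_; find)
open import Data.Empty using (⊥-elim)
open import Relation.Nullary using (¬_; yes; no)
open import Relation.Nullary.Decidable using (¬¬-excluded-middle)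
import Relation.Binary.PropositionalEquality as ≡
open import Algebra.Bundles using (CommutativeRing)
import Algebra.Definitions.RawMagma as RawMagmaDefinitions
import Algebra.Properties.Ring as RingProperties
import Algebra.Properties.AbelianGroup as AbelianGroupProperties
import Algebra.Properties.CommutativeSemigroup.Divisibility as Divisibility
import Relation.Binary.Reasoning.Setoid as SetoidReasoning

¬¬-filter : ∀ {a p} {A : Set a} (P : A → Set p) (xs : List A) →
  ¬ ¬ (Σ (List A) λ ys → All P ys × (∀ {x} → x ∈ xs → P x → x ∈ ys))
¬¬-filter P [] k = k ([] , [] , λ ())
¬¬-filter P (x ∷ xs) k = ¬¬-filter P xs λ (ys , Pys , xs⊆ys) → ¬¬-excluded-middle λ where
  (yes Px) → k (x ∷ ys , Px ∷ Pys , λ where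
    (here ≡.refl) _ → here ≡.refl
    (there x∈xs) Px′ → there (xs⊆ys x∈xs Px′))
  (no ¬Px) → k (ys , Pys , λ where
    (here ≡.refl) Px → ⊥-elim (¬Px Px)
    (there x∈xs) Px′ → xs⊆ys x∈xs Px′)

module _ {c ℓ : Level} (D : CommutativeRing c ℓ) where
  open CommutativeRing D
  open RawMagmaDefinitions *-rawMagma using (_∣_; _,_)
  open Divisibility *-commutativeSemigroup using (x∣xy; xy≈z⇒x∣z; x∣ʳy⇒x∣ʳzy; ∣ʳ-trans)
  open RingProperties ring using (-‿distribˡ-*; -‿distribʳ-*; -‿involutive; +-inverseˡ-unique)
  open AbelianGroupProperties +-abelianGroup using (xyx⁻¹≈y)
  open SetoidReasoning setoid

  unit⇒∣1 : ∀ {u} → IsUnit D u → u ∣ 1#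
  unit⇒∣1 {u} (v , uv≈1) = v , trans (*-comm v u) uv≈1

  ∣1⇒unit : ∀ {q} → q ∣ 1# → IsUnit D q
  ∣1⇒unit {q} (v , vq≈1) = v , trans (*-comm q v) vq≈1

  ∣x∧∣x+1⇒∣1 : ∀ {q x} → q ∣ x → q ∣ x + 1# → q ∣ 1#
  ∣x∧∣x+1⇒∣1 {q} {x} (k , kq≈x) (l , lq≈x+1) = l - k , (begin
    (l - k) * q        ≈⟨ distribʳ q l (- k) ⟩
    l * q + - k * q    ≈⟨ +-congˡ (-‿distribˡ-* k q) ⟨
    l * q - k * q      ≈⟨ +-cong lq≈x+1 (-‿cong kq≈x) ⟩
    (x + 1#) - x       ≈⟨ xyx⁻¹≈y x 1# ⟩
    1#                 ∎)

  associated⇒∣ : ∀ {p x} → Associated D p x → p ∣ x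
  associated⇒∣ {p} {x} (u , (v , uv≈1) , p≈ux) = v , (begin
    v * p              ≈⟨ *-congˡ p≈ux ⟩
    v * (u * x)        ≈⟨ *-assoc v u x ⟨
    (v * u) * x        ≈⟨ *-congʳ (trans (*-comm v u) uv≈1) ⟩
    1# * x             ≈⟨ *-identityˡ x ⟩
    x                  ∎)

  ∈⇒∣product : ∀ {x xs} → x ∈ xs → x ∣ product D xs
  ∈⇒∣product {xs = x ∷ xs} (here ≡.refl) = x∣xy x (product D xs)
  ∈⇒∣product {xs = y ∷ xs} (there x∈xs) = x∣ʳy⇒x∣ʳzy y (∈⇒∣product x∈xs)

  irreducible⇒≉0 : ∀ {p} → IsIrreducible D p → ¬ (p ≈ 0#)
  irreducible⇒≉0 {p} (p-nonunit , p-irr) p≈0 with p-irr 0# 0# (trans p≈0 (sym (zeroˡ 0#)))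
  ... | inj₁ (v , 0v≈1) = p-nonunit (v , trans (*-congʳ p≈0) 0v≈1)
  ... | inj₂ (v , 0v≈1) = p-nonunit (v , trans (*-congʳ p≈0) 0v≈1)

  associated-irreducible⇒≉0 : ∀ {p x} → IsIrreducible D p → Associated D p x → ¬ (x ≈ 0#)
  associated-irreducible⇒≉0 {x = x} p-irr (u , _ , p≈ux) x≈0 =
    irreducible⇒≉0 p-irr (trans p≈ux (trans (*-congˡ x≈0) (zeroʳ u)))

  pow-1 : ∀ n → pow D 1# n ≈ 1#
  pow-1 zero = refl
  pow-1 (suc n) = trans (*-congˡ (pow-1 n)) (*-identityˡ 1#)

  powˢᵘᶜ+1≈0⇒unit : ∀ {x} m → pow D x (suc m) + 1# ≈ 0# → IsUnit D x
  powˢᵘᶜ+1≈0⇒unit {x} m xⁿ+1≈0 = - pow D x m , (begin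
    x * - pow D x m    ≈⟨ -‿distribʳ-* x (pow D x m) ⟨
    - pow D x (suc m)  ≈⟨ -‿cong (+-inverseˡ-unique _ _ xⁿ+1≈0) ⟩
    - - 1#             ≈⟨ -‿involutive 1# ⟩
    1#                 ∎)

  unit-pow+1⇒solution : ∀ {x} n → ¬ (x ≈ 0#) → IsUnit D (pow D x n + 1#) →
    HasUnitFermatSolution D n
  unit-pow+1⇒solution {x} n x≉0 w-unit =
    1# , 1# , pow D x n + 1# , x , 1# , 1# ,
    one-unit , one-unit , w-unit , x≉0 , 1≉0 , 1≉0 , (begin
      1# * pow D x n + 1# * pow D 1# n  ≈⟨ +-cong (*-identityˡ _) (trans (*-identityˡ _) (pow-1 n)) ⟩
      pow D x n + 1#                    ≈⟨ *-identityʳ _ ⟨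
      (pow D x n + 1#) * 1#             ≈⟨ *-congˡ (pow-1 n) ⟨
      (pow D x n + 1#) * pow D 1# n     ∎)
    where
    one-unit : IsUnit D 1#
    one-unit = 1# , *-identityˡ 1#
    1≉0 : ¬ (1# ≈ 0#)
    1≉0 1≈0 = x≉0 (begin
      x       ≈⟨ *-identityʳ x ⟨
      x * 1#  ≈⟨ *-congˡ 1≈0 ⟩
      x * 0#  ≈⟨ zeroʳ x ⟩
      0#      ∎)

  1+1≉0 : Containsℕ D → ¬ (1# + 1# ≈ 0#)
  1+1≉0 ι-injective 2≈0 with ι-injective 2 0 (trans (+-congˡ (+-identityʳ 1#)) 2≈0)
  ... | ()

  irreducible-factor : IsAtomic D → ∀ {x} → ¬ (x ≈ 0#) → ¬ IsUnit D x →
    ∃ λ q → IsIrreducible D q × q ∣ x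
  irreducible-factor atomic x≉0 x-nonunit with atomic _ x≉0 x-nonunit
  ... | [] , _ , 1≈x = ⊥-elim (x-nonunit (1# , trans (*-identityʳ _) (sym 1≈x)))
  ... | q ∷ qs , q-irr ∷ _ , qΠ≈x = q , q-irr , xy≈z⇒x∣z q (product D qs) qΠ≈x

  irreducible∣product-of-cover : ∀ {xs ys} →
    (∀ p → IsIrreducible D p → Any (Associated D p) xs) →
    (∀ {x} → x ∈ xs → ¬ (x ≈ 0#) → x ∈ ys) →
    ∀ {q} → IsIrreducible D q → q ∣ product D ys
  irreducible∣product-of-cover cover xs⊆ys q-irr =
    let x , x∈xs , q~x = find (cover _ q-irr)
        x≉0 = associated-irreducible⇒≉0 q-irr q~x
    in ∣ʳ-trans (associated⇒∣ q~x) (∈⇒∣product (xs⊆ys x∈xs x≉0))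

  module _ (isDomain : IsIntegralDomain D) where

    product-≉0 : ∀ {xs} → All (λ x → ¬ (x ≈ 0#)) xs → ¬ (product D xs ≈ 0#)
    product-≉0 {[]} [] 1≈0 = proj₁ isDomain 1≈0
    product-≉0 {x ∷ xs} (x≉0 ∷ xs≉0) xΠ≈0 with proj₂ isDomain x (product D xs) xΠ≈0
    ... | inj₁ x≈0 = x≉0 x≈0
    ... | inj₂ Π≈0 = product-≉0 xs≉0 Π≈0

    module _ (ι-injective : Containsℕ D) (atomic : IsAtomic D)
             {m : ℕ} (no-solution : ¬ HasUnitFermatSolution D (suc m)) where

      ¬¬pow+1≈0 : ∀ {x} → ¬ (x ≈ 0#) → (∀ {q} → IsIrreducible D q → q ∣ x) →
        ¬ ¬ (pow D x (suc m) + 1# ≈ 0#)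
      ¬¬pow+1≈0 {x} x≉0 irreducible∣x w≉0 =
        let q , q-irr , q∣w = irreducible-factor atomic w≉0
              (λ w-unit → no-solution (unit-pow+1⇒solution (suc m) x≉0 w-unit))
            q∣xⁿ = ∣ʳ-trans (irreducible∣x q-irr) (x∣xy x (pow D x m))
        in proj₁ q-irr (∣1⇒unit (∣x∧∣x+1⇒∣1 q∣xⁿ q∣w))

      ¬nonzero-multiple-of-all-irreducibles : ∀ {x} → ¬ (x ≈ 0#) →
        ¬ (∀ {q} → IsIrreducible D q → q ∣ x)
      ¬nonzero-multiple-of-all-irreducibles {x} x≉0 irreducible∣x =
        ¬¬pow+1≈0 x≉0 irreducible∣x λ xⁿ+1≈0 →
          ¬¬pow+1≈0 (proj₁ isDomain) (irreducible∣1 xⁿ+1≈0) λ 1ⁿ+1≈0 →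
            1+1≉0 ι-injective (trans (+-congʳ (sym (pow-1 (suc m)))) 1ⁿ+1≈0)
        where
        irreducible∣1 : pow D x (suc m) + 1# ≈ 0# → ∀ {q} → IsIrreducible D q → q ∣ 1#
        irreducible∣1 xⁿ+1≈0 q-irr = ∣ʳ-trans (irreducible∣x q-irr)
          (unit⇒∣1 (powˢᵘᶜ+1≈0⇒unit m xⁿ+1≈0))

theorem3p1 : {c ℓ : Level} (D : CommutativeRing c ℓ) →
    IsIntegralDomain D → Containsℕ D → IsAtomic D →
    Σ ℕ (λ n → n ≥ 2 × ¬ HasUnitFermatSolution D n) →
    ¬ FinitelyManyIrreducibles D
theorem3p1 D _ _ _ (zero , () , _)
theorem3p1 D isDomain ι-injective atomic (suc m , _ , no-solution) (xs , cover) =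
  ¬¬-filter (λ x → ¬ (x ≈ 0#)) xs λ (ys , ys≉0 , xs⊆ys) →
    ¬nonzero-multiple-of-all-irreducibles D isDomain ι-injective atomic {m} no-solution
      (product-≉0 D isDomain ys≉0) (irreducible∣product-of-cover D cover xs⊆ys)
  where open CommutativeRing D using (_≈_; 0#)
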